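{- Let $N\in\mathbb{N}$. Then for every positive integer $n$, \begin{equation*} a(n, N) = \mathrm{ssptd}_{o}(n, N) - \mathrm{ssptd}_{o}(n-N, N). \end{equation*}
   Context: $a(n,N)$ is the number of partitions $\pi$ of $n$ with largest part $l(\pi)\leq N$ in which only the largest part may repeat. $\mathrm{ssptd}_o(n,N)$ is the sum of the smallest parts $s(\pi)$ over all partitions $\pi$ of $n$ into an odd number of distinct parts satisfying $l(\pi)-s(\pi)\leq N-1$; it is $0$ for $n\leq 0$. -}

module Defs where

open import Data.Nat using (ℕ; zero; suc; _+_; _∸_; _≤ᵇ_; _<ᵇ_; _≡ᵇ_)
open import Data.Bool using (Bool; true; false; _∧_; _∨_; not; if_then_else_)
open import Data.Nat.ListAction using (sum)
open import Data.List using (List; []; _∷_; length; filter; map; concatMap; applyUpTo)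
open import Data.Integer using (ℤ; +_; _-_)

-- Partitions are represented as lists of parts written in NON-INCREASING order.
-- Each partition of n corresponds to exactly one such list.

listsOf : ℕ → ℕ → List (List ℕ)
listsOf zero    m = [] ∷ []
listsOf (suc k) m = concatMap (λ x → map (x ∷_) (listsOf k m)) (applyUpTo suc m)

-- finite superset of all partitions of n: lists of length ≤ n, entries in {1,…,n}
candidates : ℕ → List (List ℕ)
candidates n = concatMap (λ k → listsOf k n) (applyUpTo (λ i → i) (suc n))

nonIncreasing : List ℕ → Bool
nonIncreasing []           = true
nonIncreasing (x ∷ [])     = true
nonIncreasing (x ∷ y ∷ xs) = (y ≤ᵇ x) ∧ nonIncreasing (y ∷ xs)

strictlyDecreasing : List ℕ → Bool
strictlyDecreasing []           = true
strictlyDecreasing (x ∷ [])     = true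
strictlyDecreasing (x ∷ y ∷ xs) = (y <ᵇ x) ∧ strictlyDecreasing (y ∷ xs)

isPartitionOf : ℕ → List ℕ → Bool
isPartitionOf n xs = nonIncreasing xs ∧ (sum xs ≡ᵇ n)

partitions : ℕ → List (List ℕ)
partitions n = filter (λ xs → isPartitionOf n xs Data.Bool.≟ true) (candidates n)
  where import Data.Bool

-- largest part (first entry), 0 for the empty partition
largest : List ℕ → ℕ
largest []      = 0
largest (x ∷ _) = x

-- smallest part (last entry), 0 for the empty partition
smallest : List ℕ → ℕ
smallest []           = 0
smallest (x ∷ [])     = x
smallest (x ∷ y ∷ xs) = smallest (y ∷ xs)

onlyLargestRepeatsFrom : ℕ → List ℕ → Bool
onlyLargestRepeatsFrom l []           = true
onlyLargestRepeatsFrom l (x ∷ [])     = true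
onlyLargestRepeatsFrom l (x ∷ y ∷ xs) =
  (not (x ≡ᵇ y) ∨ (x ≡ᵇ l)) ∧ onlyLargestRepeatsFrom l (y ∷ xs)

onlyLargestRepeats : List ℕ → Bool
onlyLargestRepeats xs = onlyLargestRepeatsFrom (largest xs) xs

isOdd : ℕ → Bool
isOdd zero          = false
isOdd (suc zero)    = true
isOdd (suc (suc k)) = isOdd k

a : ℕ → ℕ → ℕ
a n N = length (filter (λ p → (largest p ≤ᵇ N) ∧ onlyLargestRepeats p Data.Bool.≟ true)
                       (partitions n))
  where import Data.Bool

-- condition for ssptd_o: odd number of distinct parts with l(π) - s(π) ≤ N - 1
-- (written l(π) - s(π) + 1 ≤ N, valid over ℤ, hence also for N = 0)
ssptdCond : ℕ → List ℕ → Bool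
ssptdCond N p = strictlyDecreasing p ∧ isOdd (length p)
                ∧ (suc (largest p ∸ smallest p) ≤ᵇ N)

ssptdoℕ : ℕ → ℕ → ℕ
ssptdoℕ n N = sum (map smallest (filter (λ p → ssptdCond N p Data.Bool.≟ true) (partitions n)))
  where import Data.Bool

ssptdo : ℤ → ℕ → ℕ
ssptdo (ℤ.pos n)    N = ssptdoℕ n N
ssptdo (ℤ.negsuc _) N = 0

-- Write S_N(n) for the partitions of n into an odd number of distinct parts with
-- l(π) − s(π) < N. Since s(π) = (l(π) ∸ N) + (s(π) − (l(π) ∸ N)) on S_N(n), ssptd_o(n, N)
-- splits into a "shift" sum of l(π) ∸ N and an "excess" sum of s(π) − (l(π) ∸ N). Moving
-- the largest part l(π) > N to the end as l(π) − N is a bijection from the members of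
-- S_N(n) with l(π) > N onto S_N(n − N) that turns l(π) − N into the smallest part, so the
-- shift sum is ssptd_o(n − N, N). The excess of π counts the l ≤ N with l(π) − s(π) < l ≤ l(π),
-- so it suffices to show, for each l ≥ 1, that the partitions counted by a with largest
-- part exactly l are as many as the odd distinct partitions with l(π) − s(π) < l ≤ l(π).
-- Both counts vanish below l, and removing a largest part equal to l (together with the
-- rotation above for l(π) > l) shows that both grow from n to l + n by the number of
-- partitions of n into distinct parts smaller than l.
module Submission where

open import Defs
open import Data.Bool using (Bool; true; false; _∧_; not; if_then_else_; T)
import Data.Bool as Bool
open import Data.Bool.Properties using (T-≡; ∨-zeroʳ; ∨-identityʳ)
open import Data.Empty using (⊥-elim)
open import Data.List
  using (List; []; _∷_; [_]; _∷ʳ_; map; filter; length; drop; concatMap; applyUpTo; initLast; _∷ʳ′_)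
open import Data.List.Membership.Propositional using (_∈_; find)
open import Data.List.Membership.Propositional.Properties
  using (∈-filter⁺; ∈-filter⁻; ∈-map⁺; ∈-map⁻; ∈-concatMap⁺; ∈-concatMap⁻; ∈-applyUpTo⁺; ∈-applyUpTo⁻)
open import Data.List.Membership.Propositional.Properties.WithK using (unique∧set⇒bag)
open import Data.List.Properties using (map-cong-local; map-∘; ∷-injectiveʳ; length-++)
open import Data.List.Relation.Binary.BagAndSetEquality using (∼bag⇒↭)
open import Data.List.Relation.Binary.Permutation.Propositional using (_↭_)
import Data.List.Relation.Binary.Permutation.Propositional.Properties as Permutation
open import Data.List.Relation.Unary.All as All using (All; []; _∷_)
import Data.List.Relation.Unary.All.Properties as All
open import Data.List.Relation.Unary.AllPairs as AllPairs using ([]; _∷_)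
import Data.List.Relation.Unary.AllPairs.Properties as AllPairs
open import Data.List.Relation.Unary.Any as Any using (here; there)
open import Data.List.Relation.Unary.Linked as Linked using (Linked; []; [-]; _∷_)
open import Data.List.Relation.Unary.Linked.Properties using (Linked⇒All)
open import Data.List.Relation.Unary.Unique.Propositional using (Unique)
import Data.List.Relation.Unary.Unique.Propositional.Properties as Unique
open import Data.Nat
  using (ℕ; zero; suc; pred; _+_; _∸_; _≤_; _<_; _≥_; _>_; z≤n; s≤s; _≤ᵇ_; _<ᵇ_; _≡ᵇ_;
         NonZero; >-nonZero; >-nonZero⁻¹)
open import Data.Nat.Induction using (<-rec)
open import Data.Nat.ListAction using (sum)
open import Data.Nat.ListAction.Properties using (sum-++; sum-↭)
open import Data.Nat.Properties
open import Algebra.Properties.CommutativeSemigroup +-commutativeSemigroup using (interchange; x∙yz≈y∙xz)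
open import Data.Product using (_×_; _,_; proj₁; proj₂)
open import Function using (_∘_; flip; case_of_)
open import Function.Bundles using (mk⇔; Equivalence)
open import Relation.Binary.Definitions using (Transitive)
open import Relation.Binary.PropositionalEquality hiding ([_])
open import Relation.Nullary.Decidable using (yes; no)
open import Relation.Nullary.Negation using (¬_)
open import Relation.Nullary.Reflects
  using (Reflects; ofʸ; ofⁿ; T-reflects; fromEquivalence; _×-reflects_)

private
  variable
    A B : Set

∑ : List A → (A → ℕ) → ℕ
∑ xs f = sum (map f xs)

syntax ∑ xs (λ x → e) = ∑[ x ∈ xs ] e

when : Bool → ℕ → ℕ
when c n = if c then n else 0

when-0 : ∀ c → when c 0 ≡ 0
when-0 false = refl
when-0 true  = refl

when-∧ : ∀ c d n → when (c ∧ d) n ≡ when c (when d n)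
when-∧ false d n = refl
when-∧ true  d n = refl

when-+ : ∀ c m n → when c (m + n) ≡ when c m + when c n
when-+ false m n = refl
when-+ true  m n = refl

when-comm : ∀ c d n → when c (when d n) ≡ when d (when c n)
when-comm false d n = sym (when-0 d)
when-comm true  d n = refl

when-cong : ∀ c {m n} → (T c → m ≡ n) → when c m ≡ when c n
when-cong false _  = refl
when-cong true  eq = eq _

when-yes : ∀ {P : Set} {c} n → Reflects P c → P → when c n ≡ n
when-yes n (ofʸ _)  _ = refl
when-yes n (ofⁿ ¬p) p = ⊥-elim (¬p p)

when-no : ∀ {P : Set} {c} n → Reflects P c → ¬ P → when c n ≡ 0
when-no n (ofʸ p) ¬p = ⊥-elim (¬p p)
when-no n (ofⁿ _) _  = refl

reflects⁻ : ∀ {P : Set} {c} → Reflects P c → T c → P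
reflects⁻ (ofʸ p) _ = p

reflects⁺ : ∀ {P : Set} {c} → Reflects P c → P → T c
reflects⁺ (ofʸ _)  _ = _
reflects⁺ (ofⁿ ¬p) p = ¬p p

∑-0 : ∀ (xs : List A) → ∑[ x ∈ xs ] 0 ≡ 0
∑-0 []       = refl
∑-0 (x ∷ xs) = ∑-0 xs

∑-+ : ∀ (xs : List A) f g → ∑[ x ∈ xs ] (f x + g x) ≡ ∑ xs f + ∑ xs g
∑-+ []       f g = refl
∑-+ (x ∷ xs) f g = trans (cong (f x + g x +_) (∑-+ xs f g)) (interchange (f x) (g x) _ _)

∑-cong : ∀ {xs : List A} {f g} → (∀ {x} → x ∈ xs → f x ≡ g x) → ∑ xs f ≡ ∑ xs g
∑-cong f≗g = cong sum (map-cong-local (All.tabulate f≗g))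

filter-true : (A → Bool) → List A → List A
filter-true P = filter (λ x → P x Bool.≟ true)

∈-filter-true⁻ : ∀ (P : A → Bool) {xs x} → x ∈ filter-true P xs → x ∈ xs × T (P x)
∈-filter-true⁻ P x∈ with x∈xs , Px ← ∈-filter⁻ (λ x → P x Bool.≟ true) x∈ = x∈xs , Equivalence.from T-≡ Px

∈-filter-true⁺ : ∀ (P : A → Bool) {xs x} → x ∈ xs → T (P x) → x ∈ filter-true P xs
∈-filter-true⁺ P x∈xs Px = ∈-filter⁺ (λ x → P x Bool.≟ true) x∈xs (Equivalence.to T-≡ Px)

∑-filter : ∀ (P : A → Bool) w xs → sum (map w (filter-true P xs)) ≡ ∑[ x ∈ xs ] when (P x) (w x)
∑-filter P w []       = refl
∑-filter P w (x ∷ xs) with P x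
... | true  = cong (w x +_) (∑-filter P w xs)
... | false = ∑-filter P w xs

length-filter : ∀ (P : A → Bool) xs → length (filter-true P xs) ≡ ∑[ x ∈ xs ] when (P x) 1
length-filter P []       = refl
length-filter P (x ∷ xs) with P x
... | true  = cong suc (length-filter P xs)
... | false = length-filter P xs

module _ {xs : List A} {ys : List B} (P : A → Bool) (Q : B → Bool) (f : A → B) (g : B → A)
         (f-maps : ∀ {x} → x ∈ xs → T (P x) → f x ∈ ys × T (Q (f x)) × g (f x) ≡ x)
         (g-maps : ∀ {y} → y ∈ ys → T (Q y) → g y ∈ xs × T (P (g y)) × f (g y) ≡ y)
         where

  private
    map-unique : ∀ {zs} → (∀ {z} → z ∈ zs → g (f z) ≡ z) → Unique zs → Unique (map f zs)
    map-unique {[]}     gf []          = []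
    map-unique {z ∷ zs} gf (z∉ ∷ zs!) =
      All.map⁺ (All.tabulate λ z′∈ fz≡fz′ →
        All.lookup z∉ z′∈ (trans (sym (gf (here refl))) (trans (cong g fz≡fz′) (gf (there z′∈)))))
      ∷ map-unique (gf ∘ there) zs!

  ∑-bijection : Unique xs → Unique ys → ∀ w →
                ∑[ x ∈ xs ] when (P x) (w (f x)) ≡ ∑[ y ∈ ys ] when (Q y) (w y)
  ∑-bijection xs! ys! w = begin
    ∑[ x ∈ xs ] when (P x) (w (f x))       ≡⟨ ∑-filter P (w ∘ f) xs ⟨
    sum (map (w ∘ f) (filter-true P xs))   ≡⟨ cong sum (map-∘ (filter-true P xs)) ⟩
    sum (map w (map f (filter-true P xs))) ≡⟨ sum-↭ (Permutation.map⁺ w image↭selection) ⟩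
    sum (map w (filter-true Q ys))         ≡⟨ ∑-filter Q w ys ⟩
    ∑[ y ∈ ys ] when (Q y) (w y)           ∎
    where
    open ≡-Reasoning
    to : ∀ {y} → y ∈ map f (filter-true P xs) → y ∈ filter-true Q ys
    to y∈ with x , x∈ , refl ← ∈-map⁻ f y∈
          with x∈xs , Px ← ∈-filter-true⁻ P x∈
          with fx∈ys , Qfx , _ ← f-maps x∈xs Px
          = ∈-filter-true⁺ Q fx∈ys Qfx
    from : ∀ {y} → y ∈ filter-true Q ys → y ∈ map f (filter-true P xs)
    from y∈ with y∈ys , Qy ← ∈-filter-true⁻ Q y∈
            with gy∈xs , Pgy , fgy≡y ← g-maps y∈ys Qy
            = subst (_∈ map f (filter-true P xs)) fgy≡y (∈-map⁺ f (∈-filter-true⁺ P gy∈xs Pgy))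
    image-unique : Unique (map f (filter-true P xs))
    image-unique = map-unique (λ x∈ → let x∈xs , Px = ∈-filter-true⁻ P x∈ in proj₂ (proj₂ (f-maps x∈xs Px)))
                              (Unique.filter⁺ _ xs!)
    image↭selection : map f (filter-true P xs) ↭ filter-true Q ys
    image↭selection = ∼bag⇒↭ (unique∧set⇒bag image-unique (Unique.filter⁺ _ ys!) (mk⇔ to from))

concatMap-unique : ∀ {xs : List A} (F : A → List B) (tag : B → A) →
                   (∀ {x y} → y ∈ F x → tag y ≡ x) →
                   (∀ x → Unique (F x)) → Unique xs → Unique (concatMap F xs)
concatMap-unique F tag tagged F! xs! =
  Unique.concat⁺ (All.map⁺ (All.tabulate λ {x} _ → F! x)) (AllPairs.map⁺ (AllPairs.map disjoint xs!))
  where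
  disjoint : ∀ {x x′} → x ≢ x′ → ∀ {y} → ¬ (y ∈ F x × y ∈ F x′)
  disjoint x≢x′ (y∈Fx , y∈Fx′) = x≢x′ (trans (sym (tagged y∈Fx)) (tagged y∈Fx′))

≡ᵇ-reflects-≡ : ∀ m n → Reflects (m ≡ n) (m ≡ᵇ n)
≡ᵇ-reflects-≡ m n = fromEquivalence (≡ᵇ⇒≡ m n) (≡⇒≡ᵇ m n)

≡ᵇ-refl : ∀ n → (n ≡ᵇ n) ≡ true
≡ᵇ-refl zero    = refl
≡ᵇ-refl (suc n) = ≡ᵇ-refl n

<⇒≡ᵇ-false : ∀ {m n} → m < n → (m ≡ᵇ n) ≡ false
<⇒≡ᵇ-false {zero}  (s≤s _)   = refl
<⇒≡ᵇ-false {suc m} (s≤s m<n) = <⇒≡ᵇ-false m<n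

≤⇒not-≡ᵇ : ∀ {m n} → m ≤ n → not (n ≡ᵇ m) ≡ (m <ᵇ n)
≤⇒not-≡ᵇ {zero} {zero}  _         = refl
≤⇒not-≡ᵇ {zero} {suc n} _         = refl
≤⇒not-≡ᵇ        (s≤s m≤n)         = ≤⇒not-≡ᵇ m≤n

<ᵇ-suc : ∀ m n → (m <ᵇ suc n) ≡ (m ≤ᵇ n)
<ᵇ-suc zero    n = refl
<ᵇ-suc (suc m) n = refl

when-≤ᵇ : ∀ m n k → when (m ≤ᵇ n) k ≡ when (m <ᵇ n) k + when (m ≡ᵇ n) k
when-≤ᵇ zero    zero    k = refl
when-≤ᵇ zero    (suc n) k = sym (+-identityʳ k)
when-≤ᵇ (suc m) zero    k = refl
when-≤ᵇ (suc m) (suc n) k = trans (cong (λ c → when c k) (<ᵇ-suc m n)) (when-≤ᵇ m n k)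

when-∧-≤ᵇ : ∀ c m n k → when c (when (m ≤ᵇ n) k) ≡ when (c ∧ (m <ᵇ n)) k + when (c ∧ (m ≡ᵇ n)) k
when-∧-≤ᵇ c m n k = begin
  when c (when (m ≤ᵇ n) k)                         ≡⟨ cong (when c) (when-≤ᵇ m n k) ⟩
  when c (when (m <ᵇ n) k + when (m ≡ᵇ n) k)       ≡⟨ when-+ c _ _ ⟩
  when c (when (m <ᵇ n) k) + when c (when (m ≡ᵇ n) k)
    ≡⟨ cong₂ _+_ (when-∧ c (m <ᵇ n) k) (when-∧ c (m ≡ᵇ n) k) ⟨
  when (c ∧ (m <ᵇ n)) k + when (c ∧ (m ≡ᵇ n)) k    ∎
  where open ≡-Reasoning

isOdd-suc : ∀ n → isOdd (suc n) ≡ not (isOdd n)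
isOdd-suc zero          = refl
isOdd-suc (suc zero)    = refl
isOdd-suc (suc (suc n)) = isOdd-suc n

module _ {R : A → A → Set} where

  Linked-∷ʳ⁺ : ∀ {ys t} → Linked R ys → All (λ y → R y t) ys → Linked R (ys ∷ʳ t)
  Linked-∷ʳ⁺ []        []           = [-]
  Linked-∷ʳ⁺ [-]       (Ryt ∷ [])   = Ryt ∷ [-]
  Linked-∷ʳ⁺ (r ∷ ys↓) (_ ∷ ys-R-t) = r ∷ Linked-∷ʳ⁺ ys↓ ys-R-t

  Linked-∷ʳ⁻ : Transitive R → ∀ {ys t} → Linked R (ys ∷ʳ t) → Linked R ys × All (λ y → R y t) ys
  Linked-∷ʳ⁻ R-trans {[]}         _         = [] , []
  Linked-∷ʳ⁻ R-trans {y ∷ []}     (Ryt ∷ _) = [-] , Ryt ∷ []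
  Linked-∷ʳ⁻ R-trans {y ∷ z ∷ zs} (Ryz ∷ zs↓)
    with zs↓′ , zs-R-t ← Linked-∷ʳ⁻ R-trans {z ∷ zs} zs↓
    = Ryz ∷ zs↓′ , R-trans Ryz (All.head zs-R-t) ∷ zs-R-t

module _ {R : ℕ → ℕ → Set} where

  Linked-∷-largest : ∀ {x q} → R x (largest q) → Linked R q → Linked R (x ∷ q)
  Linked-∷-largest Rxq []      = [-]
  Linked-∷-largest Rxq [-]     = Rxq ∷ [-]
  Linked-∷-largest Rxq (r ∷ q) = Rxq ∷ r ∷ q

  Linked-largest-tail : ∀ {x xs} → R x 0 → Linked R (x ∷ xs) → R x (largest xs)
  Linked-largest-tail {xs = []}    Rx0 _  = Rx0
  Linked-largest-tail {xs = _ ∷ _} _   x↓ = Linked.head x↓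

nonIncreasing-reflects : ∀ xs → Reflects (Linked _≥_ xs) (nonIncreasing xs)
nonIncreasing-reflects []           = ofʸ []
nonIncreasing-reflects (x ∷ [])     = ofʸ [-]
nonIncreasing-reflects (x ∷ y ∷ xs)
  with y ≤ᵇ x | ≤ᵇ-reflects-≤ y x | nonIncreasing (y ∷ xs) | nonIncreasing-reflects (y ∷ xs)
... | true  | ofʸ y≤x | true  | ofʸ yxs↓  = ofʸ (y≤x ∷ yxs↓)
... | true  | ofʸ _   | false | ofⁿ ¬yxs↓ = ofⁿ (¬yxs↓ ∘ Linked.tail)
... | false | ofⁿ y≰x | _     | _         = ofⁿ (y≰x ∘ Linked.head)

strictlyDecreasing-reflects : ∀ xs → Reflects (Linked _>_ xs) (strictlyDecreasing xs)
strictlyDecreasing-reflects []           = ofʸ []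
strictlyDecreasing-reflects (x ∷ [])     = ofʸ [-]
strictlyDecreasing-reflects (x ∷ y ∷ xs)
  with y <ᵇ x | <ᵇ-reflects-< y x | strictlyDecreasing (y ∷ xs) | strictlyDecreasing-reflects (y ∷ xs)
... | true  | ofʸ y<x | true  | ofʸ yxs↓  = ofʸ (y<x ∷ yxs↓)
... | true  | ofʸ _   | false | ofⁿ ¬yxs↓ = ofⁿ (¬yxs↓ ∘ Linked.tail)
... | false | ofⁿ y≮x | _     | _         = ofⁿ (y≮x ∘ Linked.head)

parts≤largest : ∀ {p} → Linked _≥_ p → All (_≤ largest p) p
parts≤largest {[]}    _  = []
parts≤largest {_ ∷ _} p↓ = Linked⇒All (flip ≤-trans) ≤-refl p↓

largest≤largest-∷ʳ : ∀ ys t → largest ys ≤ largest (ys ∷ʳ t)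
largest≤largest-∷ʳ []      t = z≤n
largest≤largest-∷ʳ (y ∷ _) t = ≤-refl

smallest-∷ʳ : ∀ ys t → smallest (ys ∷ʳ t) ≡ t
smallest-∷ʳ []           t = refl
smallest-∷ʳ (y ∷ [])     t = refl
smallest-∷ʳ (y ∷ z ∷ zs) t = smallest-∷ʳ (z ∷ zs) t

smallest-∈ : ∀ x xs → smallest (x ∷ xs) ∈ x ∷ xs
smallest-∈ x []       = here refl
smallest-∈ x (y ∷ ys) = there (smallest-∈ y ys)

smallest≤parts : ∀ {p} → Linked _≥_ p → All (smallest p ≤_) p
smallest≤parts {p} p↓ with initLast p
... | []       = []
... | ys ∷ʳ′ t rewrite smallest-∷ʳ ys t =
  All.++⁺ (proj₂ (Linked-∷ʳ⁻ (flip ≤-trans) p↓)) (≤-refl ∷ [])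

smallest≤largest : ∀ {p} → Linked _≥_ p → smallest p ≤ largest p
smallest≤largest {[]}    _  = z≤n
smallest≤largest {_ ∷ _} p↓ = All.head (smallest≤parts p↓)

dropLast : List ℕ → List ℕ
dropLast []           = []
dropLast (x ∷ [])     = []
dropLast (x ∷ y ∷ xs) = x ∷ dropLast (y ∷ xs)

dropLast-∷ʳ : ∀ ys t → dropLast (ys ∷ʳ t) ≡ ys
dropLast-∷ʳ []           t = refl
dropLast-∷ʳ (y ∷ [])     t = refl
dropLast-∷ʳ (y ∷ z ∷ zs) t = cong (y ∷_) (dropLast-∷ʳ (z ∷ zs) t)

sum-∷ʳ : ∀ ys t → sum (ys ∷ʳ t) ≡ sum ys + t
sum-∷ʳ ys t = trans (sum-++ ys [ t ]) (cong (sum ys +_) (+-identityʳ t))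

length-∷ʳ : ∀ (ys : List ℕ) t → length (ys ∷ʳ t) ≡ suc (length ys)
length-∷ʳ ys t = trans (length-++ ys) (+-comm (length ys) 1)

onlyLargestRepeatsFrom-∷ : ∀ l q → onlyLargestRepeatsFrom l (l ∷ q) ≡ onlyLargestRepeatsFrom l q
onlyLargestRepeatsFrom-∷ l []      = refl
onlyLargestRepeatsFrom-∷ l (y ∷ q) rewrite ≡ᵇ-refl l | ∨-zeroʳ (not (l ≡ᵇ y)) = refl

onlyLargestRepeatsFrom-below : ∀ {l q} → Linked _≥_ q → All (_< l) q →
                               onlyLargestRepeatsFrom l q ≡ strictlyDecreasing q
onlyLargestRepeatsFrom-below []  _ = refl
onlyLargestRepeatsFrom-below [-] _ = refl
onlyLargestRepeatsFrom-below {l} {x ∷ y ∷ q} (y≤x ∷ q↓) (x<l ∷ q<l)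
  rewrite <⇒≡ᵇ-false x<l | ∨-identityʳ (not (x ≡ᵇ y)) | ≤⇒not-≡ᵇ y≤x
  = cong ((y <ᵇ x) ∧_) (onlyLargestRepeatsFrom-below q↓ q<l)

record IsPartition (n : ℕ) (p : List ℕ) : Set where
  field
    descending : Linked _≥_ p
    sums-to    : sum p ≡ n
    positive   : All (0 <_) p

open IsPartition

Bounded : ℕ → List ℕ → Set
Bounded m = All (λ x → 0 < x × x ≤ m)

∈-listsOf⁻ : ∀ k m {ys} → ys ∈ listsOf k m → length ys ≡ k × Bounded m ys
∈-listsOf⁻ zero    m (here refl) = refl , []
∈-listsOf⁻ (suc k) m ys∈
  with _ , x∈ , ys∈′ ← find (∈-concatMap⁻ (λ x → map (x ∷_) (listsOf k m)) {xs = applyUpTo suc m} ys∈)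
  with _ , zs∈ , refl ← ∈-map⁻ _ ys∈′
  with i , i<m , refl ← ∈-applyUpTo⁻ suc x∈
  with |zs|≡k , zs-bounded ← ∈-listsOf⁻ k m zs∈
  = cong suc |zs|≡k , (s≤s z≤n , i<m) ∷ zs-bounded

∈-listsOf⁺ : ∀ m {ys} → Bounded m ys → ys ∈ listsOf (length ys) m
∈-listsOf⁺ m []                                     = here refl
∈-listsOf⁺ m {suc i ∷ ys} ((_ , i<m) ∷ ys-bounded) =
  ∈-concatMap⁺ (λ x → map (x ∷_) (listsOf (length ys) m))
    (Any.map (λ { refl → ∈-map⁺ (suc i ∷_) (∈-listsOf⁺ m ys-bounded) }) (∈-applyUpTo⁺ suc i<m))

-- Lists of a fixed length are told apart by their first entries, read here with largest.
listsOf-unique : ∀ k m → Unique (listsOf k m)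
listsOf-unique zero    m = [] ∷ []
listsOf-unique (suc k) m =
  concatMap-unique _ largest (λ y∈ → case ∈-map⁻ _ y∈ of λ { (_ , _ , refl) → refl })
    (λ x → Unique.map⁺ ∷-injectiveʳ (listsOf-unique k m))
    (Unique.applyUpTo⁺₁ suc m (λ i<j _ → <⇒≢ (s≤s i<j)))

∈-candidates⁻ : ∀ n {ys} → ys ∈ candidates n → All (0 <_) ys
∈-candidates⁻ n ys∈
  with k , _ , ys∈′ ← find (∈-concatMap⁻ (λ k → listsOf k n) {xs = applyUpTo (λ i → i) (suc n)} ys∈)
  = All.map proj₁ (proj₂ (∈-listsOf⁻ k n ys∈′))

∈-candidates⁺ : ∀ n {ys} → length ys ≤ n → Bounded n ys → ys ∈ candidates n
∈-candidates⁺ n |ys|≤n ys-bounded =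
  ∈-concatMap⁺ (λ k → listsOf k n)
    (Any.map (λ { refl → ∈-listsOf⁺ n ys-bounded }) (∈-applyUpTo⁺ (λ i → i) (s≤s |ys|≤n)))

candidates-unique : ∀ n → Unique (candidates n)
candidates-unique n =
  concatMap-unique _ length (λ {k} y∈ → proj₁ (∈-listsOf⁻ k n y∈))
    (λ k → listsOf-unique k n) (Unique.applyUpTo⁺₁ (λ i → i) (suc n) (λ i<j _ → <⇒≢ i<j))

length≤sum : ∀ {ys} → All (0 <_) ys → length ys ≤ sum ys
length≤sum []           = z≤n
length≤sum (y>0 ∷ ys>0) = +-mono-≤ y>0 (length≤sum ys>0)

positive⇒bounded : ∀ {ys} → All (0 <_) ys → Bounded (sum ys) ys
positive⇒bounded []                     = []
positive⇒bounded {y ∷ ys} (y>0 ∷ ys>0) =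
  (y>0 , m≤m+n y (sum ys))
  ∷ All.map (λ (x>0 , x≤) → x>0 , ≤-trans x≤ (m≤n+m (sum ys) y)) (positive⇒bounded ys>0)

isPartitionOf-reflects : ∀ n p → Reflects (Linked _≥_ p × sum p ≡ n) (isPartitionOf n p)
isPartitionOf-reflects n p = nonIncreasing-reflects p ×-reflects ≡ᵇ-reflects-≡ (sum p) n

∈-partitions⁻ : ∀ {n p} → p ∈ partitions n → IsPartition n p
∈-partitions⁻ {n} {p} p∈
  with p∈candidates , isPartition ← ∈-filter-true⁻ (isPartitionOf n) p∈
  with p↓ , sum≡n ← reflects⁻ (isPartitionOf-reflects n p) isPartition
  = record { descending = p↓ ; sums-to = sum≡n ; positive = ∈-candidates⁻ n p∈candidates }

∈-partitions⁺ : ∀ {n p} → IsPartition n p → p ∈ partitions n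
∈-partitions⁺ {n} {p} record { descending = p↓ ; sums-to = refl ; positive = p>0 } =
  ∈-filter-true⁺ (isPartitionOf n) (∈-candidates⁺ n (length≤sum p>0) (positive⇒bounded p>0))
    (reflects⁺ (isPartitionOf-reflects n p) (p↓ , refl))

partitions-unique : ∀ n → Unique (partitions n)
partitions-unique n = Unique.filter⁺ (λ xs → isPartitionOf n xs Bool.≟ true) (candidates-unique n)

∑ₚ-cong : ∀ n {f g : List ℕ → ℕ} → (∀ {p} → IsPartition n p → f p ≡ g p) →
          ∑[ p ∈ partitions n ] f p ≡ ∑[ p ∈ partitions n ] g p
∑ₚ-cong n f≗g = ∑-cong (f≗g ∘ ∈-partitions⁻)

∑ₚ-bijection : ∀ {m n} (P Q : List ℕ → Bool) (f g : List ℕ → List ℕ) →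
  (∀ {p} → IsPartition m p → T (P p) → IsPartition n (f p) × T (Q (f p)) × g (f p) ≡ p) →
  (∀ {q} → IsPartition n q → T (Q q) → IsPartition m (g q) × T (P (g q)) × f (g q) ≡ q) →
  ∀ w → ∑[ p ∈ partitions m ] when (P p) (w (f p)) ≡ ∑[ q ∈ partitions n ] when (Q q) (w q)
∑ₚ-bijection {m} {n} P Q f g f-maps g-maps =
  ∑-bijection P Q f g (on-partitions {R = P} {Q} {f} {g} f-maps) (on-partitions {R = Q} {P} {g} {f} g-maps)
              (partitions-unique m) (partitions-unique n)
  where
  on-partitions : ∀ {a b} {R S : List ℕ → Bool} {h h′ : List ℕ → List ℕ} →
    (∀ {p} → IsPartition a p → T (R p) → IsPartition b (h p) × T (S (h p)) × h′ (h p) ≡ p) →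
    ∀ {p} → p ∈ partitions a → T (R p) → h p ∈ partitions b × T (S (h p)) × h′ (h p) ≡ p
  on-partitions maps p∈ Rp with hp , Shp , eq ← maps (∈-partitions⁻ p∈) Rp = ∈-partitions⁺ hp , Shp , eq

largest≤n : ∀ {n p} → IsPartition n p → largest p ≤ n
largest≤n {p = []}     _    = z≤n
largest≤n {p = x ∷ xs} part = subst (x ≤_) (sums-to part) (m≤m+n x (sum xs))

largest>0 : ∀ {n p} → 0 < n → IsPartition n p → 0 < largest p
largest>0 {p = []}    n>0 part = subst (0 <_) (sym (sums-to part)) n>0
largest>0 {p = _ ∷ _} _   part = All.head (positive part)

smallest>0 : ∀ {n x xs} → IsPartition n (x ∷ xs) → 0 < smallest (x ∷ xs)
smallest>0 {x = x} {xs} part = All.lookup (positive part) (smallest-∈ x xs)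

module _ {l k : ℕ} where

  tail-isPartition : ∀ {q} → IsPartition (l + k) (l ∷ q) → IsPartition k q
  tail-isPartition part = record
    { descending = Linked.tail (descending part)
    ; sums-to    = +-cancelˡ-≡ l _ _ (sums-to part)
    ; positive   = All.tail (positive part)
    }

  ∷-isPartition : ∀ {q} → 0 < l → largest q ≤ l → IsPartition k q → IsPartition (l + k) (l ∷ q)
  ∷-isPartition l>0 q≤l part = record
    { descending = Linked-∷-largest q≤l (descending part)
    ; sums-to    = cong (l +_) (sums-to part)
    ; positive   = l>0 ∷ positive part
    }

-- Rotating the largest part to the end

Ssptd : ℕ → List ℕ → Set
Ssptd m p = Linked _>_ p × T (isOdd (length p)) × largest p ∸ smallest p < m

ssptdCond-reflects : ∀ m p → Reflects (Ssptd m p) (ssptdCond m p)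
ssptdCond-reflects m p =
  strictlyDecreasing-reflects p ×-reflects (T-reflects _ ×-reflects <ᵇ-reflects-< _ m)

∸<⇒<+ : ∀ {m n o} → m ∸ n < o → m < n + o
∸<⇒<+ {m} {n} m∸n<o = ≤-<-trans (m≤n+m∸n m n) (+-monoʳ-< n m∸n<o)

rotate : ℕ → List ℕ → List ℕ
rotate m []       = []
rotate m (x ∷ xs) = xs ∷ʳ (x ∸ m)

unrotate : ℕ → List ℕ → List ℕ
unrotate m []       = []
unrotate m (x ∷ xs) = (smallest (x ∷ xs) + m) ∷ dropLast (x ∷ xs)

unrotate-∷ʳ : ∀ m ys t → unrotate m (ys ∷ʳ t) ≡ (t + m) ∷ ys
unrotate-∷ʳ m []       t = refl
unrotate-∷ʳ m (y ∷ ys) t = cong₂ _∷_ (cong (_+ m) (smallest-∷ʳ (y ∷ ys) t)) (dropLast-∷ʳ (y ∷ ys) t)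

rotated-spread : ∀ {m x xs} .{{_ : NonZero m}} → m ≤ x → Linked _>_ (x ∷ xs) →
                 largest (xs ∷ʳ (x ∸ m)) ∸ (x ∸ m) < m
rotated-spread {m} {x} {[]}    m≤x _         = subst (_< m) (sym (n∸n≡0 (x ∸ m))) (>-nonZero⁻¹ m)
rotated-spread {m} {x} {y ∷ _} m≤x (y<x ∷ _) =
  m<n+o⇒m∸n<o y (x ∸ m) (subst (y <_) (sym (m∸n+n≡m m≤x)) y<x)

unrotated-shape : ∀ {m ys t} .{{_ : NonZero m}} → Linked _>_ (ys ∷ʳ t) → largest (ys ∷ʳ t) ∸ t < m →
                   Linked _>_ ((t + m) ∷ ys) × largest ((t + m) ∷ ys) ∸ smallest ((t + m) ∷ ys) < m
unrotated-shape {m} {ys} {t} q↓ spread with ys↓ , ys>t ← Linked-∷ʳ⁻ (flip <-trans) q↓ =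
  Linked-∷-largest (≤-<-trans (largest≤largest-∷ʳ ys t) (∸<⇒<+ spread)) ys↓
  , All.lookup (top ∷ All.map (λ t<y → m<n+o⇒m∸n<o (t + m) _ {m} (+-monoˡ-< m t<y)) ys>t) (smallest-∈ (t + m) ys)
  where
  top : (t + m) ∸ (t + m) < m
  top = subst (_< m) (sym (n∸n≡0 (t + m))) (>-nonZero⁻¹ m)

module _ {m k : ℕ} where

  rotate-maps : ∀ {p} → IsPartition (m + k) p → T (ssptdCond m p ∧ (m <ᵇ largest p)) →
                IsPartition k (rotate m p) × T (ssptdCond m (rotate m p)) × unrotate m (rotate m p) ≡ p
  rotate-maps {p} part cond
    with reflects⁻ (ssptdCond-reflects m p ×-reflects <ᵇ-reflects-< m (largest p)) cond
  rotate-maps {[]}     _    _ | _ , ()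
  rotate-maps {x ∷ xs} part _ | (p↓ , odd , spread) , m<x =
    record { descending = Linked.map <⇒≤ q↓ ; sums-to = q-sum ; positive = q-positive }
    , reflects⁺ (ssptdCond-reflects m q) (q↓ , subst (T ∘ isOdd) (sym (length-∷ʳ xs (x ∸ m))) odd , q-spread)
    , trans (unrotate-∷ʳ m xs (x ∸ m)) (cong (_∷ xs) (m∸n+n≡m (<⇒≤ m<x)))
    where
    s : ℕ
    s = smallest (x ∷ xs)
    q : List ℕ
    q = xs ∷ʳ (x ∸ m)
    instance
      m≢0 : NonZero m
      m≢0 = >-nonZero (≤-<-trans z≤n spread)
      s≢0 : NonZero s
      s≢0 = >-nonZero (smallest>0 part)
    x∸m<s : x ∸ m < s
    x∸m<s = m<n+o⇒m∸n<o x m (subst (x <_) (+-comm s m) (∸<⇒<+ spread))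
    q↓ : Linked _>_ q
    q↓ = Linked-∷ʳ⁺ (Linked.tail p↓) (All.map (<-≤-trans x∸m<s) (All.tail (smallest≤parts (descending part))))
    q-sum : sum q ≡ k
    q-sum = +-cancelˡ-≡ m _ _ (begin
      m + sum q               ≡⟨ cong (m +_) (sum-∷ʳ xs (x ∸ m)) ⟩
      m + (sum xs + (x ∸ m))  ≡⟨ x∙yz≈y∙xz m (sum xs) (x ∸ m) ⟩
      sum xs + (m + (x ∸ m))  ≡⟨ cong (sum xs +_) (m+[n∸m]≡n (<⇒≤ m<x)) ⟩
      sum xs + x              ≡⟨ +-comm (sum xs) x ⟩
      x + sum xs              ≡⟨ sums-to part ⟩
      m + k                   ∎)
      where open ≡-Reasoning
    q-positive : All (0 <_) q
    q-positive = All.++⁺ (All.tail (positive part)) (m<n⇒0<n∸m m<x ∷ [])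
    q-spread : largest q ∸ smallest q < m
    q-spread rewrite smallest-∷ʳ xs (x ∸ m) = rotated-spread (<⇒≤ m<x) p↓

  unrotate-maps : ∀ {q} → IsPartition k q → T (ssptdCond m q) →
                  IsPartition (m + k) (unrotate m q)
                  × T (ssptdCond m (unrotate m q) ∧ (m <ᵇ largest (unrotate m q)))
                  × rotate m (unrotate m q) ≡ q
  unrotate-maps {q} part cond with initLast q | reflects⁻ (ssptdCond-reflects m q) cond
  ... | []       | _ , () , _
  ... | ys ∷ʳ′ t | q↓ , odd , spread rewrite unrotate-∷ʳ m ys t =
    record { descending = Linked.map <⇒≤ p↓ ; sums-to = p-sum ; positive = t+m>0 ∷ All.++⁻ˡ ys (positive part) }
    , reflects⁺ (ssptdCond-reflects m p ×-reflects <ᵇ-reflects-< m (t + m))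
                ((p↓ , subst (T ∘ isOdd) (length-∷ʳ ys t) odd , p-spread) , m<n+m m t>0)
    , cong (ys ∷ʳ_) (m+n∸n≡m t m)
    where
    p : List ℕ
    p = (t + m) ∷ ys
    instance
      m≢0 : NonZero m
      m≢0 = >-nonZero (≤-<-trans z≤n spread)
    p↓×p-spread : Linked _>_ p × largest p ∸ smallest p < m
    p↓×p-spread = unrotated-shape q↓ (subst (λ s → largest (ys ∷ʳ t) ∸ s < m) (smallest-∷ʳ ys t) spread)
    p↓ : Linked _>_ p
    p↓ = proj₁ p↓×p-spread
    p-spread : largest p ∸ smallest p < m
    p-spread = proj₂ p↓×p-spread
    t>0 : 0 < t
    t>0 = All.head (All.++⁻ʳ ys (positive part))
    t+m>0 : 0 < t + m
    t+m>0 = <-≤-trans t>0 (m≤m+n t m)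
    p-sum : sum p ≡ m + k
    p-sum = begin
      t + m + sum ys    ≡⟨ cong (_+ sum ys) (+-comm t m) ⟩
      m + t + sum ys    ≡⟨ +-assoc m t (sum ys) ⟩
      m + (t + sum ys)  ≡⟨ cong (m +_) (+-comm t (sum ys)) ⟩
      m + (sum ys + t)  ≡⟨ cong (m +_) (trans (sym (sum-∷ʳ ys t)) (sums-to part)) ⟩
      m + k             ∎
      where open ≡-Reasoning

∑-rotate : ∀ m k w → ∑[ p ∈ partitions (m + k) ] when (ssptdCond m p ∧ (m <ᵇ largest p)) (w (rotate m p))
                   ≡ ∑[ q ∈ partitions k ] when (ssptdCond m q) (w q)
∑-rotate m k = ∑ₚ-bijection _ _ (rotate m) (unrotate m) rotate-maps unrotate-maps

-- Partitions with a prescribed largest part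

aExact : ℕ → ℕ → ℕ
aExact l n = ∑[ p ∈ partitions n ] when (largest p ≡ᵇ l) (when (onlyLargestRepeats p) 1)

bExact : ℕ → ℕ → ℕ
bExact l n = ∑[ p ∈ partitions n ] when (ssptdCond l p) (when (l ≤ᵇ largest p) 1)

distinctBelow : ℕ → ℕ → ℕ
distinctBelow l n = ∑[ p ∈ partitions n ] when (strictlyDecreasing p) (when (largest p <ᵇ l) 1)

onlyLargestRepeatsFrom-split : ∀ {l k q} → IsPartition k q →
  when ((largest q ≤ᵇ l) ∧ onlyLargestRepeatsFrom l q) 1
  ≡ when (largest q ≡ᵇ l) (when (onlyLargestRepeats q) 1) + when (strictlyDecreasing q) (when (largest q <ᵇ l) 1)
onlyLargestRepeatsFrom-split {l} {k} {q} part = begin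
  when ((L ≤ᵇ l) ∧ olr) 1                                  ≡⟨ when-∧ (L ≤ᵇ l) olr 1 ⟩
  when (L ≤ᵇ l) (when olr 1)                               ≡⟨ when-≤ᵇ L l _ ⟩
  when (L <ᵇ l) (when olr 1) + when (L ≡ᵇ l) (when olr 1)  ≡⟨ +-comm (when (L <ᵇ l) _) _ ⟩
  when (L ≡ᵇ l) (when olr 1) + when (L <ᵇ l) (when olr 1)
    ≡⟨ cong₂ _+_ (when-cong (L ≡ᵇ l) at-top) (when-cong (L <ᵇ l) below-top) ⟩
  when (L ≡ᵇ l) (when (onlyLargestRepeats q) 1) + when (L <ᵇ l) (when (strictlyDecreasing q) 1)
    ≡⟨ cong (when (L ≡ᵇ l) _ +_) (when-comm (L <ᵇ l) _ 1) ⟩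
  when (L ≡ᵇ l) (when (onlyLargestRepeats q) 1) + when (strictlyDecreasing q) (when (L <ᵇ l) 1) ∎
  where
  open ≡-Reasoning
  L : ℕ
  L = largest q
  olr : Bool
  olr = onlyLargestRepeatsFrom l q
  at-top : T (L ≡ᵇ l) → when olr 1 ≡ when (onlyLargestRepeats q) 1
  at-top L≡ᵇl = cong (λ j → when (onlyLargestRepeatsFrom j q) 1) (sym (≡ᵇ⇒≡ L l L≡ᵇl))
  below-top : T (L <ᵇ l) → when olr 1 ≡ when (strictlyDecreasing q) 1
  below-top L<ᵇl = cong (λ c → when c 1)
    (onlyLargestRepeatsFrom-below (descending part)
      (All.map (λ x≤L → ≤-<-trans x≤L (<ᵇ⇒< L l L<ᵇl)) (parts≤largest (descending part))))

ssptdCond-parity-split : ∀ l q →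
  when (ssptdCond l q) 1 + when (strictlyDecreasing q ∧ (isOdd (suc (length q)) ∧ (largest q <ᵇ l))) 1
  ≡ when (strictlyDecreasing q) (when (largest q <ᵇ l) 1) + when (ssptdCond l q) (when (l ≤ᵇ largest q) 1)
ssptdCond-parity-split l q with strictlyDecreasing q
... | false = refl
... | true rewrite isOdd-suc (length q) with isOdd (length q)
...   | false = +-comm 0 (when (largest q <ᵇ l) 1)
...   | true with largest q <ᵇ l | <ᵇ-reflects-< (largest q) l
...     | true  | ofʸ L<l
  rewrite when-yes 1 (<ᵇ-reflects-< (largest q ∸ smallest q) l) (≤-<-trans (m∸n≤m _ (smallest q)) L<l)
        | when-no 1 (≤ᵇ-reflects-≤ l (largest q)) (<⇒≱ L<l)
        | when-0 (largest q ∸ smallest q <ᵇ l) = refl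
...     | false | ofⁿ L≮l
  rewrite when-yes 1 (≤ᵇ-reflects-≤ l (largest q)) (≮⇒≥ L≮l) = +-comm _ 0

module _ {l : ℕ} (l>0 : 0 < l) {k : ℕ} where

  ∑-dropLargest-onlyLargestRepeats : ∀ w →
    ∑[ p ∈ partitions (l + k) ] when ((largest p ≡ᵇ l) ∧ onlyLargestRepeats p) (w (drop 1 p))
    ≡ ∑[ q ∈ partitions k ] when ((largest q ≤ᵇ l) ∧ onlyLargestRepeatsFrom l q) (w q)
  ∑-dropLargest-onlyLargestRepeats = ∑ₚ-bijection _ _ (drop 1) (l ∷_) drop-maps cons-maps
    where
    drop-maps : ∀ {p} → IsPartition (l + k) p → T ((largest p ≡ᵇ l) ∧ onlyLargestRepeats p) →
                IsPartition k (drop 1 p) × T ((largest (drop 1 p) ≤ᵇ l) ∧ onlyLargestRepeatsFrom l (drop 1 p))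
                × l ∷ drop 1 p ≡ p
    drop-maps {p} part cond with reflects⁻ (≡ᵇ-reflects-≡ (largest p) l ×-reflects T-reflects _) cond
    drop-maps {[]}     _    _ | 0≡l , _ = ⊥-elim (<⇒≢ l>0 0≡l)
    drop-maps {l ∷ xs} part _ | refl , olr =
      tail-isPartition part
      , reflects⁺ (≤ᵇ-reflects-≤ _ l ×-reflects T-reflects _)
                  (Linked-largest-tail z≤n (descending part) , subst T (onlyLargestRepeatsFrom-∷ l xs) olr)
      , refl
    cons-maps : ∀ {q} → IsPartition k q → T ((largest q ≤ᵇ l) ∧ onlyLargestRepeatsFrom l q) →
                IsPartition (l + k) (l ∷ q) × T ((l ≡ᵇ l) ∧ onlyLargestRepeats (l ∷ q)) × drop 1 (l ∷ q) ≡ q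
    cons-maps {q} part cond with q≤l , olr ← reflects⁻ (≤ᵇ-reflects-≤ _ l ×-reflects T-reflects _) cond =
      ∷-isPartition l>0 q≤l part
      , reflects⁺ (≡ᵇ-reflects-≡ l l ×-reflects T-reflects _)
                  (refl , subst T (sym (onlyLargestRepeatsFrom-∷ l q)) olr)
      , refl

  ∑-dropLargest-ssptd : ∀ w →
    ∑[ p ∈ partitions (l + k) ] when (ssptdCond l p ∧ (l ≡ᵇ largest p)) (w (drop 1 p))
    ≡ ∑[ q ∈ partitions k ] when (strictlyDecreasing q ∧ (isOdd (suc (length q)) ∧ (largest q <ᵇ l))) (w q)
  ∑-dropLargest-ssptd = ∑ₚ-bijection _ _ (drop 1) (l ∷_) drop-maps cons-maps
    where
    evenBelow-reflects : ∀ q → Reflects (Linked _>_ q × T (isOdd (suc (length q))) × largest q < l)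
                                        (strictlyDecreasing q ∧ (isOdd (suc (length q)) ∧ (largest q <ᵇ l)))
    evenBelow-reflects q = strictlyDecreasing-reflects q ×-reflects (T-reflects _ ×-reflects <ᵇ-reflects-< _ l)
    drop-maps : ∀ {p} → IsPartition (l + k) p → T (ssptdCond l p ∧ (l ≡ᵇ largest p)) →
                IsPartition k (drop 1 p)
                × T (strictlyDecreasing (drop 1 p) ∧ (isOdd (suc (length (drop 1 p))) ∧ (largest (drop 1 p) <ᵇ l)))
                × l ∷ drop 1 p ≡ p
    drop-maps {p} part cond with reflects⁻ (ssptdCond-reflects l p ×-reflects ≡ᵇ-reflects-≡ l (largest p)) cond
    drop-maps {[]}     _    _ | _ , l≡0 = ⊥-elim (<⇒≢ l>0 (sym l≡0))
    drop-maps {l ∷ xs} part _ | (p↓ , odd , _) , refl =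
      tail-isPartition part , reflects⁺ (evenBelow-reflects xs) (Linked.tail p↓ , odd , Linked-largest-tail l>0 p↓) , refl
    cons-maps : ∀ {q} → IsPartition k q →
                T (strictlyDecreasing q ∧ (isOdd (suc (length q)) ∧ (largest q <ᵇ l))) →
                IsPartition (l + k) (l ∷ q) × T (ssptdCond l (l ∷ q) ∧ (l ≡ᵇ l)) × drop 1 (l ∷ q) ≡ q
    cons-maps {q} part cond with q↓ , even , q<l ← reflects⁻ (evenBelow-reflects q) cond =
      p , reflects⁺ (ssptdCond-reflects l (l ∷ q) ×-reflects ≡ᵇ-reflects-≡ l l)
                    ((Linked-∷-largest q<l q↓ , even , spread) , refl)
        , refl
      where
      p : IsPartition (l + k) (l ∷ q)
      p = ∷-isPartition l>0 (<⇒≤ q<l) part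
      instance
        l≢0 : NonZero l
        l≢0 = >-nonZero l>0
      spread : l ∸ smallest (l ∷ q) < l
      spread = m<n+o⇒m∸n<o l _ (m<n+m l (smallest>0 p))

  aExact-rec : aExact l (l + k) ≡ aExact l k + distinctBelow l k
  aExact-rec = begin
    aExact l (l + k)
      ≡⟨ ∑ₚ-cong (l + k) (λ {p} _ → sym (when-∧ (largest p ≡ᵇ l) (onlyLargestRepeats p) 1)) ⟩
    ∑[ p ∈ partitions (l + k) ] when ((largest p ≡ᵇ l) ∧ onlyLargestRepeats p) 1
      ≡⟨ ∑-dropLargest-onlyLargestRepeats (λ _ → 1) ⟩
    ∑[ q ∈ partitions k ] when ((largest q ≤ᵇ l) ∧ onlyLargestRepeatsFrom l q) 1
      ≡⟨ ∑ₚ-cong k onlyLargestRepeatsFrom-split ⟩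
    ∑[ q ∈ partitions k ] (when (largest q ≡ᵇ l) (when (onlyLargestRepeats q) 1)
                           + when (strictlyDecreasing q) (when (largest q <ᵇ l) 1))
      ≡⟨ ∑-+ (partitions k) _ _ ⟩
    aExact l k + distinctBelow l k ∎
    where open ≡-Reasoning

  bExact-rec : bExact l (l + k) ≡ bExact l k + distinctBelow l k
  bExact-rec = begin
    bExact l (l + k)
      ≡⟨ ∑ₚ-cong (l + k) (λ {p} _ → when-∧-≤ᵇ (ssptdCond l p) l (largest p) 1) ⟩
    ∑[ p ∈ partitions (l + k) ] (when (ssptdCond l p ∧ (l <ᵇ largest p)) 1
                                 + when (ssptdCond l p ∧ (l ≡ᵇ largest p)) 1)
      ≡⟨ ∑-+ (partitions (l + k)) _ _ ⟩
    ∑[ p ∈ partitions (l + k) ] when (ssptdCond l p ∧ (l <ᵇ largest p)) 1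
    + ∑[ p ∈ partitions (l + k) ] when (ssptdCond l p ∧ (l ≡ᵇ largest p)) 1
      ≡⟨ cong₂ _+_ (∑-rotate l k (λ _ → 1)) (∑-dropLargest-ssptd (λ _ → 1)) ⟩
    ∑[ q ∈ partitions k ] when (ssptdCond l q) 1
    + ∑[ q ∈ partitions k ] when (strictlyDecreasing q ∧ (isOdd (suc (length q)) ∧ (largest q <ᵇ l))) 1
      ≡⟨ ∑-+ (partitions k) _ _ ⟨
    ∑[ q ∈ partitions k ] (when (ssptdCond l q) 1
                           + when (strictlyDecreasing q ∧ (isOdd (suc (length q)) ∧ (largest q <ᵇ l))) 1)
      ≡⟨ ∑ₚ-cong k (λ {q} _ → ssptdCond-parity-split l q) ⟩
    ∑[ q ∈ partitions k ] (when (strictlyDecreasing q) (when (largest q <ᵇ l) 1)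
                           + when (ssptdCond l q) (when (l ≤ᵇ largest q) 1))
      ≡⟨ ∑-+ (partitions k) _ _ ⟩
    distinctBelow l k + bExact l k
      ≡⟨ +-comm (distinctBelow l k) (bExact l k) ⟩
    bExact l k + distinctBelow l k ∎
    where open ≡-Reasoning

module _ {l n : ℕ} (n<l : n < l) where

  aExact-small : aExact l n ≡ 0
  aExact-small = trans (∑ₚ-cong n vanishes) (∑-0 (partitions n))
    where
    vanishes : ∀ {p} → IsPartition n p → when (largest p ≡ᵇ l) (when (onlyLargestRepeats p) 1) ≡ 0
    vanishes part = when-no _ (≡ᵇ-reflects-≡ _ l) (λ L≡l → <⇒≱ n<l (subst (_≤ n) L≡l (largest≤n part)))

  bExact-small : bExact l n ≡ 0
  bExact-small = trans (∑ₚ-cong n vanishes) (∑-0 (partitions n))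
    where
    vanishes : ∀ {p} → IsPartition n p → when (ssptdCond l p) (when (l ≤ᵇ largest p) 1) ≡ 0
    vanishes {p} part =
      trans (cong (when (ssptdCond l p)) (when-no 1 (≤ᵇ-reflects-≤ l _) (λ l≤L → <⇒≱ n<l (≤-trans l≤L (largest≤n part)))))
            (when-0 (ssptdCond l p))

recurrence-unique : ∀ {l} → 0 < l → (f g h : ℕ → ℕ) →
  (∀ {n} → n < l → f n ≡ g n) → (∀ k → f (l + k) ≡ f k + h k) → (∀ k → g (l + k) ≡ g k + h k) →
  ∀ n → f n ≡ g n
recurrence-unique {l} l>0 f g h initial f-rec g-rec = <-rec (λ n → f n ≡ g n) step
  where
  step : ∀ n → (∀ {m} → m < n → f m ≡ g m) → f n ≡ g n
  step n ih with n <? l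
  ... | yes n<l = initial n<l
  ... | no  n≮l = subst (λ m → f m ≡ g m) (m+[n∸m]≡n l≤n) (begin
      f (l + k)  ≡⟨ f-rec k ⟩
      f k + h k  ≡⟨ cong (_+ h k) (ih (∸-monoʳ-< l>0 l≤n)) ⟩
      g k + h k  ≡⟨ g-rec k ⟨
      g (l + k)  ∎)
    where
    open ≡-Reasoning
    l≤n : l ≤ n
    l≤n = ≮⇒≥ n≮l
    k : ℕ
    k = n ∸ l

aExact≡bExact : ∀ {l} → 0 < l → ∀ n → aExact l n ≡ bExact l n
aExact≡bExact {l} l>0 = recurrence-unique l>0 (aExact l) (bExact l) (distinctBelow l)
  (λ n<l → trans (aExact-small n<l) (sym (bExact-small n<l)))
  (λ k → aExact-rec l>0)
  (λ k → bExact-rec l>0)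

-- Excess and shift of the smallest parts

m∸n≤o⇒m∸o≤n : ∀ {m n o} → m ∸ n ≤ o → m ∸ o ≤ n
m∸n≤o⇒m∸o≤n {m} {n} {o} m∸n≤o =
  m≤n+o⇒m∸n≤o m o (≤-trans (m≤n+m∸n m n) (≤-trans (+-monoʳ-≤ n m∸n≤o) (≤-reflexive (+-comm n o))))

∸-pred : ∀ {s x} → 0 < x → x ≤ s → s ∸ pred x ≡ s ∸ x + 1
∸-pred {s} {suc y} _ y<s = trans (+-∸-assoc 1 y<s) (+-comm 1 (s ∸ suc y))

-- For L − s < N the excess s − (L ∸ N) counts the l with L − s < l ≤ min(L, N);
-- raising N to N + 1 adds l = N + 1 exactly when L − s < N + 1 ≤ L.
excess-step : ∀ {s L} N → s ≤ L →
  when (L ∸ s <ᵇ suc N) (s ∸ (L ∸ suc N))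
  ≡ when (L ∸ s <ᵇ N) (s ∸ (L ∸ N)) + when (L ∸ s <ᵇ suc N) (when (N <ᵇ L) 1)
excess-step {s} {L} N s≤L = begin
  when (d <ᵇ suc N) v₁                           ≡⟨ cong (λ c → when c v₁) (<ᵇ-suc d N) ⟩
  when (d ≤ᵇ N) v₁                               ≡⟨ when-≤ᵇ d N v₁ ⟩
  when (d <ᵇ N) v₁ + when (d ≡ᵇ N) v₁            ≡⟨ cong₂ _+_ (when-cong (d <ᵇ N) inside) (when-cong (d ≡ᵇ N) boundary) ⟩
  when (d <ᵇ N) (v₀ + w) + when (d ≡ᵇ N) w      ≡⟨ cong (_+ when (d ≡ᵇ N) w) (when-+ (d <ᵇ N) v₀ w) ⟩
  when (d <ᵇ N) v₀ + when (d <ᵇ N) w + when (d ≡ᵇ N) w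
                                                 ≡⟨ +-assoc (when (d <ᵇ N) v₀) _ _ ⟩
  when (d <ᵇ N) v₀ + (when (d <ᵇ N) w + when (d ≡ᵇ N) w)
    ≡⟨ cong (when (d <ᵇ N) v₀ +_) (trans (sym (when-≤ᵇ d N w)) (cong (λ c → when c w) (sym (<ᵇ-suc d N)))) ⟩
  when (d <ᵇ N) v₀ + when (d <ᵇ suc N) w         ∎
  where
  open ≡-Reasoning
  d v₀ v₁ w : ℕ
  d  = L ∸ s
  v₀ = s ∸ (L ∸ N)
  v₁ = s ∸ (L ∸ suc N)
  w  = when (N <ᵇ L) 1
  inside : T (d <ᵇ N) → v₁ ≡ v₀ + w
  inside d<ᵇN with N <ᵇ L | <ᵇ-reflects-< N L
  ... | true  | ofʸ N<L = trans (cong (s ∸_) (sym (pred[m∸n]≡m∸[1+n] L N)))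
                                (∸-pred (m<n⇒0<n∸m N<L) (m∸n≤o⇒m∸o≤n (<⇒≤ (<ᵇ⇒< d N d<ᵇN))))
  ... | false | ofⁿ N≮L rewrite m≤n⇒m∸n≡0 (≮⇒≥ N≮L) | m≤n⇒m∸n≡0 (m≤n⇒m≤1+n (≮⇒≥ N≮L)) =
    sym (+-identityʳ s)
  at-top : ∀ s → s ∸ ((s + N) ∸ suc N) ≡ when (N <ᵇ s + N) 1
  at-top zero    = trans (0∸n≡0 (N ∸ suc N)) (sym (when-no 1 (<ᵇ-reflects-< N N) (<-irrefl refl)))
  at-top (suc s) rewrite m+n∸n≡m s N | when-yes 1 (<ᵇ-reflects-< N (suc s + N)) (m<n+m N (s≤s z≤n)) =
    m+n∸n≡m 1 s
  boundary : T (d ≡ᵇ N) → v₁ ≡ w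
  boundary d≡ᵇN = subst (λ L → s ∸ (L ∸ suc N) ≡ when (N <ᵇ L) 1)
                        (trans (cong (s +_) (sym (≡ᵇ⇒≡ d N d≡ᵇN))) (m+[n∸m]≡n s≤L)) (at-top s)

∸≡smallest-rotate : ∀ N p → largest p ∸ N ≡ when (N <ᵇ largest p) (smallest (rotate N p))
∸≡smallest-rotate N []       = 0∸n≡0 N
∸≡smallest-rotate N (x ∷ xs) with N <ᵇ x | <ᵇ-reflects-< N x
... | true  | ofʸ _   = sym (smallest-∷ʳ xs (x ∸ N))
... | false | ofⁿ N≮x = m≤n⇒m∸n≡0 (≮⇒≥ N≮x)

ssptdExcess : ℕ → ℕ → ℕ
ssptdExcess N n = ∑[ p ∈ partitions n ] when (ssptdCond N p) (smallest p ∸ (largest p ∸ N))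

ssptdShift : ℕ → ℕ → ℕ
ssptdShift N n = ∑[ p ∈ partitions n ] when (ssptdCond N p) (largest p ∸ N)

module _ (n : ℕ) where

  a-suc : ∀ N → a n (suc N) ≡ a n N + aExact (suc N) n
  a-suc N = begin
    a n (suc N)
      ≡⟨ length-filter _ (partitions n) ⟩
    ∑[ p ∈ partitions n ] when ((largest p ≤ᵇ suc N) ∧ onlyLargestRepeats p) 1
      ≡⟨ ∑ₚ-cong n (λ {p} _ → split p) ⟩
    ∑[ p ∈ partitions n ] (when ((largest p ≤ᵇ N) ∧ onlyLargestRepeats p) 1
                           + when (largest p ≡ᵇ suc N) (when (onlyLargestRepeats p) 1))
      ≡⟨ ∑-+ (partitions n) _ _ ⟩
    ∑[ p ∈ partitions n ] when ((largest p ≤ᵇ N) ∧ onlyLargestRepeats p) 1 + aExact (suc N) n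
      ≡⟨ cong (_+ aExact (suc N) n) (length-filter _ (partitions n)) ⟨
    a n N + aExact (suc N) n ∎
    where
    open ≡-Reasoning
    split : ∀ p → when ((largest p ≤ᵇ suc N) ∧ onlyLargestRepeats p) 1
                  ≡ when ((largest p ≤ᵇ N) ∧ onlyLargestRepeats p) 1
                    + when (largest p ≡ᵇ suc N) (when (onlyLargestRepeats p) 1)
    split p rewrite when-∧ (largest p ≤ᵇ suc N) (onlyLargestRepeats p) 1
                  | when-∧ (largest p ≤ᵇ N) (onlyLargestRepeats p) 1
                  | when-≤ᵇ (largest p) (suc N) (when (onlyLargestRepeats p) 1)
                  | <ᵇ-suc (largest p) N = refl

  a-zero : 0 < n → a n 0 ≡ 0
  a-zero n>0 = trans (length-filter _ (partitions n)) (trans (∑ₚ-cong n vanishes) (∑-0 (partitions n)))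
    where
    vanishes : ∀ {p} → IsPartition n p → when ((largest p ≤ᵇ 0) ∧ onlyLargestRepeats p) 1 ≡ 0
    vanishes {p} part = trans (when-∧ (largest p ≤ᵇ 0) _ 1)
                              (when-no _ (≤ᵇ-reflects-≤ _ 0) (<⇒≱ (largest>0 n>0 part)))

  ssptdExcess-zero : ssptdExcess 0 n ≡ 0
  ssptdExcess-zero = trans (∑ₚ-cong n (λ {p} _ → when-no _ (ssptdCond-reflects 0 p) λ ())) (∑-0 (partitions n))

  ssptdExcess-suc : ∀ N → ssptdExcess (suc N) n ≡ ssptdExcess N n + bExact (suc N) n
  ssptdExcess-suc N = trans (∑ₚ-cong n step) (∑-+ (partitions n) _ _)
    where
    step : ∀ {p} → IsPartition n p →
           when (ssptdCond (suc N) p) (smallest p ∸ (largest p ∸ suc N))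
           ≡ when (ssptdCond N p) (smallest p ∸ (largest p ∸ N))
             + when (ssptdCond (suc N) p) (when (suc N ≤ᵇ largest p) 1)
    step {p} part with strictlyDecreasing p | isOdd (length p)
    ... | false | _     = refl
    ... | true  | false = refl
    ... | true  | true  = excess-step N (smallest≤largest (descending part))

  a≡ssptdExcess : 0 < n → ∀ N → a n N ≡ ssptdExcess N n
  a≡ssptdExcess n>0 zero    = trans (a-zero n>0) (sym ssptdExcess-zero)
  a≡ssptdExcess n>0 (suc N) = begin
    a n (suc N)                          ≡⟨ a-suc N ⟩
    a n N + aExact (suc N) n             ≡⟨ cong₂ _+_ (a≡ssptdExcess n>0 N) (aExact≡bExact (s≤s z≤n) n) ⟩
    ssptdExcess N n + bExact (suc N) n   ≡⟨ ssptdExcess-suc N ⟨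
    ssptdExcess (suc N) n                ∎
    where open ≡-Reasoning

  ssptdo-split : ∀ N → ssptdoℕ n N ≡ ssptdShift N n + ssptdExcess N n
  ssptdo-split N = begin
    ssptdoℕ n N                                              ≡⟨ ∑-filter (ssptdCond N) smallest (partitions n) ⟩
    ∑[ p ∈ partitions n ] when (ssptdCond N p) (smallest p)  ≡⟨ ∑ₚ-cong n (λ {p} _ → split p) ⟩
    ∑[ p ∈ partitions n ] (when (ssptdCond N p) (largest p ∸ N) + when (ssptdCond N p) (smallest p ∸ (largest p ∸ N)))
                                                             ≡⟨ ∑-+ (partitions n) _ _ ⟩
    ssptdShift N n + ssptdExcess N n                         ∎
    where
    open ≡-Reasoning
    split : ∀ p → when (ssptdCond N p) (smallest p)
                  ≡ when (ssptdCond N p) (largest p ∸ N) + when (ssptdCond N p) (smallest p ∸ (largest p ∸ N))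
    split p = trans (when-cong (ssptdCond N p) λ c →
                      let _ , _ , spread = reflects⁻ (ssptdCond-reflects N p) c
                      in sym (m+[n∸m]≡n (m∸n≤o⇒m∸o≤n (<⇒≤ spread))))
                    (when-+ (ssptdCond N p) _ _)

ssptdShift-+ : ∀ N k → ssptdShift N (N + k) ≡ ssptdoℕ k N
ssptdShift-+ N k = begin
  ssptdShift N (N + k)
    ≡⟨ ∑ₚ-cong (N + k) (λ {p} _ → rotated p) ⟩
  ∑[ p ∈ partitions (N + k) ] when (ssptdCond N p ∧ (N <ᵇ largest p)) (smallest (rotate N p))
    ≡⟨ ∑-rotate N k smallest ⟩
  ∑[ q ∈ partitions k ] when (ssptdCond N q) (smallest q)
    ≡⟨ ∑-filter (ssptdCond N) smallest (partitions k) ⟨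
  ssptdoℕ k N ∎
  where
  open ≡-Reasoning
  rotated : ∀ p → when (ssptdCond N p) (largest p ∸ N)
                  ≡ when (ssptdCond N p ∧ (N <ᵇ largest p)) (smallest (rotate N p))
  rotated p = trans (cong (when (ssptdCond N p)) (∸≡smallest-rotate N p)) (sym (when-∧ (ssptdCond N p) _ _))

ssptdShift-< : ∀ {N n} → n < N → ssptdShift N n ≡ 0
ssptdShift-< {N} {n} n<N = trans (∑ₚ-cong n vanishes) (∑-0 (partitions n))
  where
  vanishes : ∀ {p} → IsPartition n p → when (ssptdCond N p) (largest p ∸ N) ≡ 0
  vanishes {p} part = trans (cong (when (ssptdCond N p)) (m≤n⇒m∸n≡0 (<⇒≤ (≤-<-trans (largest≤n part) n<N))))
                            (when-0 (ssptdCond N p))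

-- Imported only here: its prefix +_ makes ℕ sections such as (m +_) ambiguous.
open import Data.Integer using (+_; _-_)
open import Data.Integer.Properties using ([+m]-[+n]≡m⊖n; ⊖-≥; ⊖-<)

+[m+n]-+m≡+n : ∀ m n → + (m + n) - + m ≡ + n
+[m+n]-+m≡+n m n = trans ([+m]-[+n]≡m⊖n (m + n) m) (trans (⊖-≥ (m≤m+n m n)) (cong +_ (m+n∸m≡n m n)))

ssptdShift≡ssptdo : ∀ N n → ssptdShift N n ≡ ssptdo (+ n - + N) N
ssptdShift≡ssptdo N n rewrite [+m]-[+n]≡m⊖n n N with N ≤? n
... | yes N≤n rewrite ⊖-≥ N≤n =
  subst (λ m → ssptdShift N m ≡ ssptdoℕ (n ∸ N) N) (m+[n∸m]≡n N≤n) (ssptdShift-+ N (n ∸ N))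
... | no  N≰n rewrite ⊖-< (≰⇒> N≰n) with N ∸ n | m<n⇒0<n∸m (≰⇒> N≰n)
...   | suc _ | _ = ssptdShift-< (≰⇒> N≰n)

theorem2p7 : (N n : ℕ) → .{{_ : NonZero n}} →
    + a n N ≡ + ssptdo (+ n) N - + ssptdo (+ n - + N) N
theorem2p7 N n = begin
  + a n N                                                  ≡⟨ cong +_ (a≡ssptdExcess n (>-nonZero⁻¹ n) N) ⟩
  + ssptdExcess N n                                        ≡⟨ +[m+n]-+m≡+n (ssptdShift N n) _ ⟨
  + (ssptdShift N n + ssptdExcess N n) - + ssptdShift N n
    ≡⟨ cong₂ (λ x y → + x - + y) (sym (ssptdo-split n N)) (ssptdShift≡ssptdo N n) ⟩
  + ssptdo (+ n) N - + ssptdo (+ n - + N) N                ∎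
  where open ≡-Reasoning
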